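{- Let $M$ and $N$ be equirestrictive $0$-$1$ matrices and let $A$ be any $0$-$1$ matrix. Then the block matrices $[M|A]=\begin{pmatrix} M&0\\0&A\end{pmatrix}$ and $[N|A]=\begin{pmatrix} N&0\\0&A\end{pmatrix}$ are equirestrictive.
   Context: A Ferrers diagram of shape $(\lambda_1\ge\cdots\ge\lambda_c)$ has $\lambda_i$ left-justified cells in row $i$ (rows top to bottom, columns left to right). A filling assigns a nonnegative integer to each cell (empty means $0$). For an $s\times t$ $0$-$1$ matrix $M$, a filling contains $M$ if there are rows $r_1<\cdots<r_s$ and columns $c_1<\cdots<c_t$ such that the cell $(r_s,c_t)$ is in the diagram and the cell $(r_i,c_j)$ is nonempty whenever $M_{i,j}=1$; otherwise it avoids $M$. A diagram with prescribed row and column sums is a diagram together with sequences $(\rho_i),(\gamma_j)$ of nonnegative integers such that only fillings with $i$-th row sum $\rho_i$ and $j$-th column sum $\gamma_j$ are allowed. Two matrices are equirestrictive if for every diagram with prescribed row and column sums the numbers of allowed fillings avoiding each of them are equal. -}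

module Defs where

open import Data.Nat using (ℕ; zero; suc; _+_; _≤_; _<_)
open import Data.Fin using (Fin; toℕ; fromℕ; splitAt) renaming (_<_ to _<ᶠ_; _≤_ to _≤ᶠ_)
open import Data.Bool using (Bool; true; false)
open import Data.Sum using (_⊎_; inj₁; inj₂)
open import Data.Product using (Σ; _×_; ∃; ∃-syntax)
open import Data.Vec using (Vec; lookup; map; sum)
open import Data.List using (List; length)
open import Data.List.Membership.Propositional using (_∈_)
open import Data.List.Relation.Unary.Unique.Propositional using (Unique)
open import Relation.Binary.PropositionalEquality using (_≡_; _≢_)
open import Relation.Nullary using (¬_)
open import Function.Bundles using (_⇔_)

-- A 0-1 matrix with (suc s) rows and (suc t) columns (matrices are nonempty).
Matrix01 : ℕ → ℕ → Set
Matrix01 s t = Fin (suc s) → Fin (suc t) → Bool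

block : ∀ {s t s' t'} → Matrix01 s t → Matrix01 s' t' → Matrix01 (s + suc s') (t + suc t')
block {s} {t} M A i j with splitAt (suc s) i | splitAt (suc t) j
... | inj₁ i' | inj₁ j' = M i' j'
... | inj₂ i' | inj₂ j' = A i' j'
... | inj₁ _  | inj₂ _  = false
... | inj₂ _  | inj₁ _  = false

-- A Ferrers diagram with c rows and d columns: row i has λ i left-justified
-- cells; rows are weakly decreasing, every row and every column is nonempty.
record Ferrers (c d : ℕ) : Set where
  field
    shape      : Fin c → ℕ
    decreasing : ∀ i j → i ≤ᶠ j → shape j ≤ shape i
    rowsNonempty : ∀ i → 1 ≤ shape i
    withinCols : ∀ i → shape i ≤ d
    colsNonempty : ∀ (j : Fin d) → ∃[ i ] (toℕ j < shape i)
open Ferrers public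

InDiagram : ∀ {c d} → Ferrers c d → Fin c → Fin d → Set
InDiagram D i j = toℕ j < shape D i

Filling : ℕ → ℕ → Set
Filling c d = Vec (Vec ℕ d) c

entry : ∀ {c d} → Filling c d → Fin c → Fin d → ℕ
entry F i j = lookup (lookup F i) j

rowSum : ∀ {c d} → Filling c d → Fin c → ℕ
rowSum F i = sum (lookup F i)

colSum : ∀ {c d} → Filling c d → Fin d → ℕ
colSum F j = sum (map (λ row → lookup row j) F)

Allowed : ∀ {c d} → Ferrers c d → (Fin c → ℕ) → (Fin d → ℕ) → Filling c d → Set
Allowed D ρ γ F =
  (∀ i j → ¬ InDiagram D i j → entry F i j ≡ 0) ×
  (∀ i → rowSum F i ≡ ρ i) ×
  (∀ j → colSum F j ≡ γ j)

StrictlyIncreasing : ∀ {m n} → (Fin m → Fin n) → Set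
StrictlyIncreasing f = ∀ i j → i <ᶠ j → f i <ᶠ f j

Contains : ∀ {s t c d} → Matrix01 s t → Ferrers c d → Filling c d → Set
Contains {s} {t} {c} {d} M D F =
  Σ (Fin (suc s) → Fin c) λ r →
  Σ (Fin (suc t) → Fin d) λ k →
    StrictlyIncreasing r × StrictlyIncreasing k ×
    InDiagram D (r (fromℕ s)) (k (fromℕ t)) ×
    (∀ i j → M i j ≡ true → entry F (r i) (k j) ≢ 0)

Avoids : ∀ {s t c d} → Matrix01 s t → Ferrers c d → Filling c d → Set
Avoids M D F = ¬ Contains M D F

HasCard : {X : Set} → (X → Set) → ℕ → Set
HasCard {X} P n = Σ (List X) λ xs → length xs ≡ n × Unique xs × (∀ x → (x ∈ xs) ⇔ P x)

Equirestrictive : ∀ {s t s' t'} → Matrix01 s t → Matrix01 s' t' → Set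
Equirestrictive M N =
  ∀ c d (D : Ferrers c d) (ρ : Fin c → ℕ) (γ : Fin d → ℕ) (n : ℕ) →
    HasCard (λ F → Allowed D ρ γ F × Avoids M D F) n ⇔
    HasCard (λ F → Allowed D ρ γ F × Avoids N D F) n

-- Call a cell of a filling F shadowed when some occurrence of A lies strictly below and to the
-- right of it. The shadow is a Ferrers diagram determined by the entries of F outside it, so the
-- fillings with a given outside part K are exactly K plus the fillings of the shadow D′ of K, with
-- the margins of K subtracted. An occurrence of [M|A] is an occurrence of M whose bottom-right cell
-- is shadowed, i.e. an occurrence of M in the shadow part. Hence, fibre by fibre over K, the
-- [M|A]-avoiders correspond to the M-avoiders of D′, which are as many as the N-avoiders of D′;
-- matching the fibres position by position yields a bijection onto the [N|A]-avoiders.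

module Submission where

open import Defs
open import Data.Nat using (ℕ; zero; suc; _+_; _∸_; _≤_; _<_; z≤n; s≤s; s≤s⁻¹; _≤?_; _<?_; _≟_)
open import Data.Nat.Properties
open import Algebra.Properties.CommutativeMonoid.Sum +-0-commutativeMonoid
  using (sum; sum-cong-≗; sum-replicate-zero; ∑-distrib-+)
open import Data.Bool using (true)
import Data.Bool.Properties as Bool
open import Data.Empty using (⊥-elim)
open import Data.Fin as Fin using (Fin; toℕ; fromℕ; fromℕ<; inject≤; cast; splitAt; _↑ˡ_; _↑ʳ_)
open import Data.Fin.Properties
  using (any?; all?; toℕ<n; toℕ-injective; toℕ-inject≤; toℕ-fromℕ<; toℕ-fromℕ; cast-involutive; ≤fromℕ;
         toℕ-↑ˡ; toℕ-↑ʳ; splitAt⁻¹-↑ˡ; splitAt⁻¹-↑ʳ; splitAt-↑ˡ; splitAt-↑ʳ)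
open import Data.List as List using (List; []; _∷_; length; filter)
open import Data.List.Properties using (length-map)
import Data.List.Relation.Unary.All as All
import Data.List.Relation.Unary.All.Properties as Allₚ
open import Data.List.Relation.Unary.AllPairs using ([]; _∷_)
open import Data.List.Relation.Unary.Any as Any using (here; there)
open import Data.List.Relation.Unary.Any.Properties using (lookup-index)
open import Data.List.Relation.Unary.Unique.Propositional using (Unique)
open import Data.List.Relation.Unary.Unique.Propositional.Properties using (filter⁺)
open import Data.List.Membership.Propositional using (_∈_)
open import Data.List.Membership.Propositional.Properties
  using (∈-map⁺; ∈-map⁻; ∈-filter⁺; ∈-filter⁻; ∈-lookup)
import Data.List.Membership.DecPropositional as DecMembership
open import Data.Product using (Σ; _×_; _,_; proj₁; proj₂; ∃; ∃₂)
open import Data.Sum using (inj₁; inj₂)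
open import Data.Vec as Vec using (Vec; []; _∷_; lookup; tabulate)
open import Data.Vec.Properties as Vecₚ using (lookup∘tabulate; tabulate∘lookup; tabulate-cong)
import Data.Vec.Functional as Vector
open import Data.Vec.Functional.Properties using (lookup-++ʳ)
open import Function using (_∘_; _∘′_)
open import Function.Bundles using (_⇔_; mk⇔; Equivalence)
open import Relation.Binary.Definitions using (DecidableEquality)
open import Relation.Binary.PropositionalEquality
open import Relation.Nullary using (¬_; Dec; yes; no)
open import Relation.Nullary.Decidable using (map′; _×-dec_; _→-dec_; ¬?)
open import Relation.Unary using (Decidable)

∑-zero : ∀ {n} {f : Fin n → ℕ} → (∀ i → f i ≡ 0) → sum f ≡ 0
∑-zero {n} f≡0 = trans (sum-cong-≗ f≡0) (sum-replicate-zero n)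

∑-+ : ∀ {n} {f g h : Fin n → ℕ} → (∀ i → f i ≡ g i + h i) → sum f ≡ sum g + sum h
∑-+ {g = g} {h} f≗g+h = trans (sum-cong-≗ f≗g+h) (∑-distrib-+ g h)

∑-inject≤ : ∀ {m n} .(m≤n : m ≤ n) (f : Fin n → ℕ) → (∀ i → m ≤ toℕ i → f i ≡ 0) →
            sum f ≡ sum (λ i → f (inject≤ i m≤n))
∑-inject≤ {zero}  {n}     _   f f≡0 = ∑-zero (λ i → f≡0 i z≤n)
∑-inject≤ {suc m} {suc n} m≤n f f≡0 =
  cong (f Fin.zero +_) (∑-inject≤ (s≤s⁻¹ m≤n) (f ∘ Fin.suc) (λ i → f≡0 (Fin.suc i) ∘ s≤s))

sum≡∑lookup : ∀ {n} (v : Vec ℕ n) → Vec.sum v ≡ sum (lookup v)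
sum≡∑lookup []      = refl
sum≡∑lookup (x ∷ v) = cong (x +_) (sum≡∑lookup v)

rowSum≡∑ : ∀ {c d} (F : Filling c d) i → rowSum F i ≡ sum (entry F i)
rowSum≡∑ F i = sum≡∑lookup (lookup F i)

colSum≡∑ : ∀ {c d} (F : Filling c d) j → colSum F j ≡ sum (λ i → entry F i j)
colSum≡∑ []          j = refl
colSum≡∑ (row ∷ F) j = cong (lookup row j +_) (colSum≡∑ F j)

-- fromEntries and inShadow? below are opaque: unfolding them during unification is very costly.
opaque
  fromEntries : ∀ {c d} → (Fin c → Fin d → ℕ) → Filling c d
  fromEntries f = tabulate (tabulate ∘ f)

  entry-fromEntries : ∀ {c d} (f : Fin c → Fin d → ℕ) i j → entry (fromEntries f) i j ≡ f i j
  entry-fromEntries f i j rewrite lookup∘tabulate (tabulate ∘ f) i = lookup∘tabulate (f i) j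

filling-ext : ∀ {c d} {F G : Filling c d} → (∀ i j → entry F i j ≡ entry G i j) → F ≡ G
filling-ext {F = F} {G} F≗G = begin
  F                   ≡⟨ tabulate∘lookup F ⟨
  tabulate (lookup F) ≡⟨ tabulate-cong row-ext ⟩
  tabulate (lookup G) ≡⟨ tabulate∘lookup G ⟩
  G                   ∎
  where
  open ≡-Reasoning
  row-ext : ∀ i → lookup F i ≡ lookup G i
  row-ext i = trans (sym (tabulate∘lookup (lookup F i)))
                (trans (tabulate-cong (F≗G i)) (tabulate∘lookup (lookup G i)))

_≟-filling_ : ∀ {c d} → DecidableEquality (Filling c d)
_≟-filling_ = Vecₚ.≡-dec (Vecₚ.≡-dec _≟_)

keepIf : ∀ {X : Set} → Dec X → ℕ → ℕ
keepIf (yes _) n = n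
keepIf (no _)  n = 0

keepIf-yes : ∀ {X : Set} (X? : Dec X) n → X → keepIf X? n ≡ n
keepIf-yes (yes _) n x = refl
keepIf-yes (no ¬x) n x = ⊥-elim (¬x x)

keepIf-no : ∀ {X : Set} (X? : Dec X) n → ¬ X → keepIf X? n ≡ 0
keepIf-no (yes x) n ¬x = ⊥-elim (¬x x)
keepIf-no (no _)  n ¬x = refl

keepIf≢0 : ∀ {X : Set} (X? : Dec X) n → keepIf X? n ≢ 0 → X × n ≢ 0
keepIf≢0 (yes x) n n≢0 = x , n≢0
keepIf≢0 (no _)  n n≢0 = ⊥-elim (n≢0 refl)

any-function? : ∀ m {n} {P : (Fin m → Fin n) → Set} →
                (∀ {f g} → f ≗ g → P f → P g) → (∀ f → Dec (P f)) → Dec (∃ P)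
any-function? zero    P-resp P? with P? (λ ())
... | yes p = yes ((λ ()) , p)
... | no ¬p = no λ (f , pf) → ¬p (P-resp (λ ()) pf)
any-function? (suc m) P-resp P? =
  map′ (λ (x , g , p) → x Vector.∷ g , p)
       (λ (f , pf) → f Fin.zero , f ∘ Fin.suc , P-resp head∷tail pf)
       (any? λ x → any-function? m (P-resp ∘ ∷-cong x) (P? ∘ (x Vector.∷_)))
  where
  head∷tail : ∀ {f} → f ≗ (f Fin.zero Vector.∷ f ∘ Fin.suc)
  head∷tail Fin.zero    = refl
  head∷tail (Fin.suc i) = refl
  ∷-cong : ∀ x {g g′} → g ≗ g′ → (x Vector.∷ g) ≗ (x Vector.∷ g′)
  ∷-cong x g≗g′ Fin.zero    = refl
  ∷-cong x g≗g′ (Fin.suc i) = g≗g′ i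

DownwardClosed : ∀ {n} → (Fin n → Set) → Set
DownwardClosed P = ∀ {j j′} → toℕ j′ ≤ toℕ j → P j → P j′

prefixLength : ∀ {n} {P : Fin n → Set} → Decidable P → ℕ
prefixLength {zero}  P? = 0
prefixLength {suc n} P? with P? Fin.zero
... | yes _ = suc (prefixLength (P? ∘ Fin.suc))
... | no _  = 0

prefixLength≤ : ∀ {n} {P : Fin n → Set} (P? : Decidable P) {m} → (∀ {j} → P j → toℕ j < m) →
                prefixLength P? ≤ m
prefixLength≤ {zero}  P? below = z≤n
prefixLength≤ {suc n} P? {zero}  below with P? Fin.zero
... | no _  = z≤n
... | yes p = ⊥-elim (n≮0 (below p))
prefixLength≤ {suc n} P? {suc m} below with P? Fin.zero
... | no _  = z≤n
... | yes _ = s≤s (prefixLength≤ (P? ∘ Fin.suc) (s≤s⁻¹ ∘ below))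

prefixLength≤n : ∀ {n} {P : Fin n → Set} (P? : Decidable P) → prefixLength P? ≤ n
prefixLength≤n P? = prefixLength≤ P? (λ {j} _ → toℕ<n j)

prefixLength-sound : ∀ {n} {P : Fin n → Set} (P? : Decidable P) {j} → toℕ j < prefixLength P? → P j
prefixLength-sound {suc n} P? {j} j<len with P? Fin.zero | j
... | yes p | Fin.zero  = p
... | yes p | Fin.suc j = prefixLength-sound (P? ∘ Fin.suc) (s≤s⁻¹ j<len)

prefixLength-complete : ∀ {n} {P : Fin n → Set} (P? : Decidable P) →
                        DownwardClosed P → ∀ {j} → P j → toℕ j < prefixLength P?
prefixLength-complete {suc n} P? closed {j} pj with P? Fin.zero | j
... | yes _  | Fin.zero  = s≤s z≤n
... | yes _  | Fin.suc j = s≤s (prefixLength-complete (P? ∘ Fin.suc) (closed ∘ s≤s) pj)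
... | no ¬p₀ | _         = ⊥-elim (¬p₀ (closed z≤n pj))

module Embedding {m n} (m≤n : m ≤ n) where

  embed : Fin m → Fin n
  embed i = inject≤ i m≤n

  toℕ-embed : ∀ i → toℕ (embed i) ≡ toℕ i
  toℕ-embed i = toℕ-inject≤ i m≤n

  unembed : (i : Fin n) → .(toℕ i < m) → Fin m
  unembed i i<m = fromℕ< i<m

  toℕ-unembed : ∀ i .(i<m : toℕ i < m) → toℕ (unembed i i<m) ≡ toℕ i
  toℕ-unembed i i<m = toℕ-fromℕ< i<m

  embed-unembed : ∀ i .(i<m : toℕ i < m) → embed (unembed i i<m) ≡ i
  embed-unembed i i<m = toℕ-injective (trans (toℕ-embed _) (toℕ-fromℕ< i<m))

  unembed-embed : ∀ i .(i<m : toℕ (embed i) < m) → unembed (embed i) i<m ≡ i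
  unembed-embed i i<m = toℕ-injective (trans (toℕ-fromℕ< i<m) (toℕ-embed i))

  embed< : ∀ i → toℕ (embed i) < m
  embed< i = subst (_< m) (sym (toℕ-embed i)) (toℕ<n i)

lookup-injective : ∀ {X : Set} {xs : List X} → Unique xs →
                   ∀ {i j} → List.lookup xs i ≡ List.lookup xs j → i ≡ j
lookup-injective (_  ∷ _)  {Fin.zero}  {Fin.zero}  _ = refl
lookup-injective (x∉ ∷ _)  {Fin.zero}  {Fin.suc j} e = ⊥-elim (All.lookup x∉ (∈-lookup j) e)
lookup-injective (x∉ ∷ _)  {Fin.suc i} {Fin.zero}  e = ⊥-elim (All.lookup x∉ (∈-lookup i) (sym e))
lookup-injective (_  ∷ xs) {Fin.suc i} {Fin.suc j} e = cong Fin.suc (lookup-injective xs e)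

map⁺-injectiveOn : ∀ {X Y : Set} {f : X → Y} {xs : List X} →
                   (∀ {x y} → x ∈ xs → y ∈ xs → f x ≡ f y → x ≡ y) → Unique xs → Unique (List.map f xs)
map⁺-injectiveOn {xs = []}     inj []         = []
map⁺-injectiveOn {xs = x ∷ xs} inj (x∉ ∷ xs!) =
  Allₚ.map⁺ (All.tabulate λ y∈ fx≡fy → All.lookup x∉ y∈ (inj (here refl) (there y∈) fx≡fy))
  ∷ map⁺-injectiveOn (λ x∈ y∈ → inj (there x∈) (there y∈)) xs!

record BijectiveOn {X Y : Set} (P : X → Set) (Q : Y → Set) (f : X → Y) : Set where
  field
    maps       : ∀ {x} → P x → Q (f x)
    injective  : ∀ {x y} → P x → P y → f x ≡ f y → x ≡ y
    surjective : ∀ {y} → Q y → ∃ λ x → P x × f x ≡ y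

module _ {X : Set} {P : X → Set} where

  HasCard-image : ∀ {Y : Set} {Q : Y → Set} {f : X → Y} {n} → BijectiveOn P Q f → HasCard P n → HasCard Q n
  HasCard-image {Q = Q} {f = f} bij (xs , refl , xs! , ∈xs⇔P) =
    List.map f xs , length-map f xs ,
    map⁺-injectiveOn (λ x∈ y∈ → injective (to x∈) (to y∈)) xs! ,
    λ y → mk⇔ (image⇒Q y) (Q⇒image y)
    where
    open BijectiveOn bij
    to : ∀ {x} → x ∈ xs → P x
    to = Equivalence.to (∈xs⇔P _)
    image⇒Q : ∀ y → y ∈ List.map f xs → Q y
    image⇒Q y y∈ with ∈-map⁻ f y∈
    ... | x , x∈ , refl = maps (to x∈)
    Q⇒image : ∀ y → Q y → y ∈ List.map f xs
    Q⇒image y qy with surjective qy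
    ... | x , px , refl = ∈-map⁺ f (Equivalence.from (∈xs⇔P x) px)

  HasCard-filter : ∀ {R : X → Set} {n} → Decidable R → HasCard P n → ∃ (HasCard (λ x → P x × R x))
  HasCard-filter R? (xs , _ , xs! , ∈xs⇔P) =
    length (filter R? xs) , filter R? xs , refl , filter⁺ R? xs! ,
    λ x → mk⇔ (λ x∈ → let x∈xs , rx = ∈-filter⁻ R? x∈ in Equivalence.to (∈xs⇔P x) x∈xs , rx)
               (λ (px , rx) → ∈-filter⁺ R? (Equivalence.from (∈xs⇔P x) px) rx)

  -- Two sets of the same finite size are matched position by position in their enumerations.
  matching : ∀ {Q : X → Set} {n} → DecidableEquality X → HasCard P n → HasCard Q n →
             Σ (X → X) (BijectiveOn P Q)
  matching {Q} _≟_ (xs , refl , xs! , ∈xs⇔P) (ys , |ys|≡ , ys! , ∈ys⇔Q) = τ , record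
    { maps       = λ {x} px → maps (x ∈? xs) px
    ; injective  = λ {x} {y} px py → injective (x ∈? xs) (y ∈? xs) px py
    ; surjective = surjective
    }
    where
    open DecMembership _≟_ using (_∈?_)
    position : ∀ {x} → x ∈ xs → Fin (length ys)
    position x∈ = cast (sym |ys|≡) (Any.index x∈)
    partner : ∀ {x} → Dec (x ∈ xs) → X
    partner {x} (yes x∈) = List.lookup ys (position x∈)
    partner {x} (no _)   = x
    τ : X → X
    τ x = partner (x ∈? xs)
    memberOf : ∀ {x} → P x → x ∈ xs
    memberOf = Equivalence.from (∈xs⇔P _)
    maps : ∀ {x} (x∈? : Dec (x ∈ xs)) → P x → Q (partner x∈?)
    maps (yes x∈) _  = Equivalence.to (∈ys⇔Q _) (∈-lookup (position x∈))
    maps (no x∉)  px = ⊥-elim (x∉ (memberOf px))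
    position-injective : ∀ {x y} (x∈ : x ∈ xs) (y∈ : y ∈ xs) → position x∈ ≡ position y∈ → x ≡ y
    position-injective {x} {y} x∈ y∈ e = begin
      x                             ≡⟨ lookup-index x∈ ⟩
      List.lookup xs (Any.index x∈) ≡⟨ cong (List.lookup xs) index≡ ⟩
      List.lookup xs (Any.index y∈) ≡⟨ lookup-index y∈ ⟨
      y                             ∎
      where
      open ≡-Reasoning
      index≡ : Any.index x∈ ≡ Any.index y∈
      index≡ = trans (sym (cast-involutive |ys|≡ (sym |ys|≡) (Any.index x∈)))
                 (trans (cong (cast |ys|≡) e) (cast-involutive |ys|≡ (sym |ys|≡) (Any.index y∈)))
    injective : ∀ {x y} (x∈? : Dec (x ∈ xs)) (y∈? : Dec (y ∈ xs)) → P x → P y →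
                partner x∈? ≡ partner y∈? → x ≡ y
    injective (yes x∈) (yes y∈) _ _ e = position-injective x∈ y∈ (lookup-injective ys! e)
    injective (no x∉)  _        px _  _ = ⊥-elim (x∉ (memberOf px))
    injective (yes _)  (no y∉)  _  py _ = ⊥-elim (y∉ (memberOf py))
    surjective : ∀ {y} → Q y → ∃ λ x → P x × τ x ≡ y
    surjective {y} qy = x , Equivalence.to (∈xs⇔P x) (∈-lookup i) , partner-x (x ∈? xs)
      where
      y∈ : y ∈ ys
      y∈ = Equivalence.from (∈ys⇔Q y) qy
      i : Fin (length xs)
      i = cast |ys|≡ (Any.index y∈)
      x : X
      x = List.lookup xs i
      partner-x : (x∈? : Dec (x ∈ xs)) → partner x∈? ≡ y
      partner-x (no x∉)  = ⊥-elim (x∉ (∈-lookup i))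
      partner-x (yes x∈) = begin
        List.lookup ys (position x∈)                 ≡⟨ cong (List.lookup ys ∘′ cast (sym |ys|≡)) index≡i ⟩
        List.lookup ys (cast (sym |ys|≡) i)
          ≡⟨ cong (List.lookup ys) (cast-involutive (sym |ys|≡) |ys|≡ (Any.index y∈)) ⟩
        List.lookup ys (Any.index y∈)                ≡⟨ lookup-index y∈ ⟨
        y                                            ∎
        where
        open ≡-Reasoning
        index≡i : Any.index x∈ ≡ i
        index≡i = lookup-injective xs! (sym (lookup-index x∈))

module FibreTransfer
  {X : Set} (_≟_ : DecidableEquality X) (κ : X → X)
  {Y : X → Set} (_≟Y_ : ∀ {k} → DecidableEquality (Y k))
  (restrict : ∀ k → X → Y k) (glue : ∀ k → Y k → X)
  (glue-restrict : ∀ x → glue (κ x) (restrict (κ x) x) ≡ x)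
  {Realisable : X → Set} (realisable? : ∀ k → Dec (Realisable k))
  where

  record Decomposes (P : X → Set) (P′ : ∀ k → Y k → Set) : Set where
    field
      realisable     : ∀ {x} → P x → Realisable (κ x)
      restrict-sound : ∀ {x} → P x → P′ (κ x) (restrict (κ x) x)
      glue-sound     : ∀ {k y} → Realisable k → P′ k y → P (glue k y)
      κ-glue         : ∀ {k y} → Realisable k → P′ k y → κ (glue k y) ≡ k
      restrict-glue  : ∀ {k y} → Realisable k → P′ k y → restrict k (glue k y) ≡ y

  glue-restrict-at : ∀ {k} x → κ x ≡ k → glue k (restrict k x) ≡ x
  glue-restrict-at x refl = glue-restrict x

  module _ {P : X → Set} {P′ : ∀ k → Y k → Set} (P≅P′ : Decomposes P P′) where
    open Decomposes P≅P′

    fibre-bijection : ∀ {k} → Realisable k → BijectiveOn (λ x → P x × κ x ≡ k) (P′ k) (restrict k)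
    fibre-bijection {k} rk = record
      { maps       = λ { (px , refl) → restrict-sound px }
      ; injective  = λ { {x} {y} (_ , κx≡k) (_ , κy≡k) e →
                         trans (sym (glue-restrict-at x κx≡k))
                               (trans (cong (glue k) e) (glue-restrict-at y κy≡k)) }
      ; surjective = λ p′y → glue k _ , (glue-sound rk p′y , κ-glue rk p′y) , restrict-glue rk p′y
      }

    fibre-count : ∀ {n} → HasCard P n → ∀ {k} → Realisable k → ∃ (HasCard (P′ k))
    fibre-count P-card {k} rk =
      let m , fibre-card = HasCard-filter (λ x → κ x ≟ k) P-card
      in m , HasCard-image (fibre-bijection rk) fibre-card

  module _ {P Q : X → Set} {P′ Q′ : ∀ k → Y k → Set}
           (P≅P′ : Decomposes P P′) (Q≅Q′ : Decomposes Q Q′)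
           (fibres : ∀ {k} → Realisable k → ∀ {m} → HasCard (P′ k) m → HasCard (Q′ k) m)
           {n} (P-card : HasCard P n)
    where
    private
      module P = Decomposes P≅P′
      module Q = Decomposes Q≅Q′

    fibre-matching : ∀ {k} → Realisable k → Σ (Y k → Y k) (BijectiveOn (P′ k) (Q′ k))
    fibre-matching rk =
      let m , P′-card = fibre-count P≅P′ P-card rk in matching _≟Y_ P′-card (fibres rk P′-card)

    transport-at : ∀ {k} → Dec (Realisable k) → X → X
    transport-at {k} (yes rk) x = glue k (proj₁ (fibre-matching rk) (restrict k x))
    transport-at     (no _)   x = x

    transport : X → X
    transport x = transport-at (realisable? (κ x)) x

    transport-at-sound : ∀ {k} (rk? : Dec (Realisable k)) {x} → P x → κ x ≡ k →
                         Q (transport-at rk? x) × κ (transport-at rk? x) ≡ k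
    transport-at-sound (yes rk) px refl = Q.glue-sound rk q′ , Q.κ-glue rk q′
      where q′ = BijectiveOn.maps (proj₂ (fibre-matching rk)) (P.restrict-sound px)
    transport-at-sound (no ¬rk) px refl = ⊥-elim (¬rk (P.realisable px))

    transport-at-injective : ∀ {k} (rk? : Dec (Realisable k)) {x y} → P x → P y → κ x ≡ k → κ y ≡ k →
                             transport-at rk? x ≡ transport-at rk? y → x ≡ y
    transport-at-injective {k} (yes rk) px py κx≡k κy≡k e =
      restrict.injective (px , κx≡k) (py , κy≡k) (τ.injective p′x p′y τ-restrict≡)
      where
      module restrict = BijectiveOn (fibre-bijection P≅P′ rk)
      module τ = BijectiveOn (proj₂ (fibre-matching rk))
      p′x = restrict.maps (px , κx≡k)
      p′y = restrict.maps (py , κy≡k)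
      τ-restrict≡ = trans (sym (Q.restrict-glue rk (τ.maps p′x)))
                          (trans (cong (restrict k) e) (Q.restrict-glue rk (τ.maps p′y)))
    transport-at-injective (no ¬rk) px _ refl _ _ = ⊥-elim (¬rk (P.realisable px))

    transport-at-surjective : ∀ {k} (rk? : Dec (Realisable k)) {y} → Q y → κ y ≡ k →
                              ∃ λ x → P x × κ x ≡ k × transport-at rk? x ≡ y
    transport-at-surjective {k} (yes rk) {y} qy refl =
      let x′ , p′x′ , τx′≡ = BijectiveOn.surjective (proj₂ (fibre-matching rk)) (Q.restrict-sound qy)
      in glue k x′ , P.glue-sound rk p′x′ , P.κ-glue rk p′x′ ,
         trans (cong (λ z → glue k (proj₁ (fibre-matching rk) z)) (P.restrict-glue rk p′x′))
               (trans (cong (glue k) τx′≡) (glue-restrict y))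
    transport-at-surjective (no ¬rk) qy refl = ⊥-elim (¬rk (Q.realisable qy))

    transport-bijective : BijectiveOn P Q transport
    transport-bijective = record
      { maps       = λ {x} px → proj₁ (transport-at-sound (realisable? (κ x)) px refl)
      ; injective  = injective
      ; surjective = surjective
      }
      where
      transport-κ : ∀ {x} → P x → κ (transport x) ≡ κ x
      transport-κ {x} px = proj₂ (transport-at-sound (realisable? (κ x)) px refl)
      injective : ∀ {x y} → P x → P y → transport x ≡ transport y → x ≡ y
      injective {x} {y} px py e = transport-at-injective (realisable? (κ x)) px py refl κy≡κx
        (trans e (cong (λ k → transport-at (realisable? k) y) κy≡κx))
        where
        κy≡κx : κ y ≡ κ x
        κy≡κx = trans (sym (transport-κ py)) (trans (cong κ (sym e)) (transport-κ px))
      surjective : ∀ {y} → Q y → ∃ λ x → P x × transport x ≡ y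
      surjective {y} qy =
        let x , px , κx≡κy , e = transport-at-surjective (realisable? (κ y)) qy refl
        in x , px , trans (cong (λ k → transport-at (realisable? k) x) κx≡κy) e

  transfer : ∀ {P Q : X → Set} {P′ Q′ : ∀ k → Y k → Set} → Decomposes P P′ → Decomposes Q Q′ →
             (∀ {k} → Realisable k → ∀ {m} → HasCard (P′ k) m → HasCard (Q′ k) m) →
             ∀ {n} → HasCard P n → HasCard Q n
  transfer P≅P′ Q≅Q′ fibres P-card = HasCard-image (transport-bijective P≅P′ Q≅Q′ fibres P-card) P-card

StrictlyIncreasing⇒monotone : ∀ {m n} {f : Fin m → Fin n} → StrictlyIncreasing f →
                              ∀ {x y} → toℕ x ≤ toℕ y → toℕ (f x) ≤ toℕ (f y)
StrictlyIncreasing⇒monotone f↑ {x} {y} x≤y with m≤n⇒m<n∨m≡n x≤y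
... | inj₁ x<y = <⇒≤ (f↑ x y x<y)
... | inj₂ x≡y rewrite toℕ-injective {i = x} {j = y} x≡y = ≤-refl

strictlyIncreasing? : ∀ {m n} (f : Fin m → Fin n) → Dec (StrictlyIncreasing f)
strictlyIncreasing? f = all? λ x → all? λ y → (toℕ x <? toℕ y) →-dec (toℕ (f x) <? toℕ (f y))

StrictlyIncreasing-resp : ∀ {m n} {f g : Fin m → Fin n} → f ≗ g → StrictlyIncreasing f → StrictlyIncreasing g
StrictlyIncreasing-resp f≗g f↑ x y x<y = subst₂ _<_ (cong toℕ (f≗g x)) (cong toℕ (f≗g y)) (f↑ x y x<y)

module _ {c d} (D : Ferrers c d) where

  inDiagram? : ∀ i j → Dec (InDiagram D i j)
  inDiagram? i j = toℕ j <? shape D i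

  InDiagram-downward : ∀ {i j i′ j′} → toℕ i′ ≤ toℕ i → toℕ j′ ≤ toℕ j →
                       InDiagram D i j → InDiagram D i′ j′
  InDiagram-downward {i} {j} {i′} i′≤i j′≤j ij∈D =
    <-≤-trans (≤-<-trans j′≤j ij∈D) (decreasing D i′ i i′≤i)


module _ {c d : ℕ} where

  -- Contains M D F unfolds to ContainsWithCorner (InDiagram D) M F.
  Occurrence : ∀ {s t} → (Fin c → Fin d → Set) → Matrix01 s t → Filling c d →
               (Fin (suc s) → Fin c) → (Fin (suc t) → Fin d) → Set
  Occurrence {s} {t} Corner M F r k =
    StrictlyIncreasing r × StrictlyIncreasing k × Corner (r (fromℕ s)) (k (fromℕ t)) ×
    (∀ a b → M a b ≡ true → entry F (r a) (k b) ≢ 0)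

  ContainsWithCorner : ∀ {s t} → (Fin c → Fin d → Set) → Matrix01 s t → Filling c d → Set
  ContainsWithCorner Corner M F = ∃₂ (Occurrence Corner M F)

  occurrence? : ∀ {s t} {Corner : Fin c → Fin d → Set} → (∀ i j → Dec (Corner i j)) →
                ∀ (M : Matrix01 s t) F r k → Dec (Occurrence Corner M F r k)
  occurrence? corner? M F r k =
    strictlyIncreasing? r ×-dec strictlyIncreasing? k ×-dec corner? _ _ ×-dec
    all? λ a → all? λ b → (M a b Bool.≟ true) →-dec ¬? (entry F (r a) (k b) ≟ 0)

  Occurrence-resp : ∀ {s t} {Corner} {M : Matrix01 s t} {F r r′ k k′} → r ≗ r′ → k ≗ k′ →
                    Occurrence Corner M F r k → Occurrence Corner M F r′ k′
  Occurrence-resp {Corner = Corner} {F = F} r≗r′ k≗k′ (r↑ , k↑ , corner , nonzero) =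
    StrictlyIncreasing-resp r≗r′ r↑ , StrictlyIncreasing-resp k≗k′ k↑ ,
    subst₂ Corner (r≗r′ _) (k≗k′ _) corner ,
    λ a b mab → subst₂ (λ x y → entry F x y ≢ 0) (r≗r′ a) (k≗k′ b) (nonzero a b mab)

  ContainsWithCorner-mono : ∀ {s t} {C C′ : Fin c → Fin d → Set} {M : Matrix01 s t} {F : Filling c d} →
                            (∀ {i j} → C i j → C′ i j) → ContainsWithCorner C M F → ContainsWithCorner C′ M F
  ContainsWithCorner-mono C⇒C′ (r , k , r↑ , k↑ , corner , nonzero) = r , k , r↑ , k↑ , C⇒C′ corner , nonzero

module ShadowOf {c d} (D : Ferrers c d) {u v} (A : Matrix01 u v) where

  record InShadow (F : Filling c d) (i : Fin c) (j : Fin d) : Set where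
    constructor shadowedBy
    field
      rows   : Fin (suc u) → Fin c
      cols   : Fin (suc v) → Fin d
      occurs : Occurrence (InDiagram D) A F rows cols
      below  : toℕ i < toℕ (rows Fin.zero)
      right  : toℕ j < toℕ (cols Fin.zero)

  opaque
    inShadow? : ∀ F i j → Dec (InShadow F i j)
    inShadow? F i j =
      map′ (λ (r , k , occ , i< , j<) → shadowedBy r k occ i< j<)
           (λ (shadowedBy r k occ i< j<) → r , k , occ , i< , j<)
           (any-function? (suc u) (λ r≗r′ (k , copy) → k , copy-resp r≗r′ (λ _ → refl) copy) λ r →
            any-function? (suc v) (copy-resp (λ _ → refl)) λ k →
            occurrence? (inDiagram? D) A F r k ×-dec (toℕ i <? _) ×-dec (toℕ j <? _))
      where
      copy-resp : ∀ {r r′ k k′} → r ≗ r′ → k ≗ k′ →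
                  Occurrence (InDiagram D) A F r k × toℕ i < toℕ (r Fin.zero) × toℕ j < toℕ (k Fin.zero) →
                  Occurrence (InDiagram D) A F r′ k′ × toℕ i < toℕ (r′ Fin.zero) × toℕ j < toℕ (k′ Fin.zero)
      copy-resp r≗r′ k≗k′ (occ , i< , j<) =
        Occurrence-resp {Corner = InDiagram D} {F = F} r≗r′ k≗k′ occ ,
        subst (λ x → toℕ i < toℕ x) (r≗r′ _) i< , subst (λ x → toℕ j < toℕ x) (k≗k′ _) j<

  InShadow-downward : ∀ {F i j i′ j′} → toℕ i′ ≤ toℕ i → toℕ j′ ≤ toℕ j →
                      InShadow F i j → InShadow F i′ j′
  InShadow-downward i′≤i j′≤j (shadowedBy r k occ i< j<) =
    shadowedBy r k occ (≤-<-trans i′≤i i<) (≤-<-trans j′≤j j<)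

  InShadow⇒InDiagram : ∀ {F i j} → InShadow F i j → InDiagram D i j
  InShadow⇒InDiagram (shadowedBy r k (r↑ , k↑ , corner , _) i< j<) =
    InDiagram-downward D (<⇒≤ (<-≤-trans i< (StrictlyIncreasing⇒monotone r↑ z≤n)))
                         (<⇒≤ (<-≤-trans j< (StrictlyIncreasing⇒monotone k↑ z≤n))) corner

  InShadow-above : ∀ {F i j} {r : Fin (suc u) → Fin c} {k : Fin (suc v) → Fin d} →
                   StrictlyIncreasing r → StrictlyIncreasing k →
                   toℕ i < toℕ (r Fin.zero) → toℕ j < toℕ (k Fin.zero) →
                   ∀ {a b} → InShadow F (r a) (k b) → InShadow F i j
  InShadow-above r↑ k↑ i< j< = InShadow-downward (<⇒≤ (<-≤-trans i< (StrictlyIncreasing⇒monotone r↑ z≤n)))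
                                                 (<⇒≤ (<-≤-trans j< (StrictlyIncreasing⇒monotone k↑ z≤n)))

  AgreeOutsideShadow : Filling c d → Filling c d → Set
  AgreeOutsideShadow F H = ∀ i j → ¬ InShadow F i j → entry H i j ≡ entry F i j

  shadowMeets? : ∀ F (r : Fin (suc u) → Fin c) (k : Fin (suc v) → Fin d) →
                 Dec (∃₂ λ a b → A a b ≡ true × InShadow F (r a) (k b))
  shadowMeets? F r k = any? λ a → any? λ b → (A a b Bool.≟ true) ×-dec inShadow? F (r a) (k b)

  -- The shadow is determined by the entries outside it: an occurrence of A witnessing (i , j)
  -- either has a nonzero cell in the shadow, which already shadows (i , j), or lies where F and H agree.

  shadow-agree-⊆ : ∀ {F H} → AgreeOutsideShadow F H → ∀ {i j} → InShadow H i j → InShadow F i j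
  shadow-agree-⊆ {F} H≈F (shadowedBy r k (r↑ , k↑ , corner , nonzero) i< j<) with shadowMeets? F r k
  ... | yes (a , b , _ , ab∈) = InShadow-above r↑ k↑ i< j< ab∈
  ... | no ¬meets = shadowedBy r k (r↑ , k↑ , corner , nonzero′) i< j<
    where
    nonzero′ : ∀ a b → A a b ≡ true → entry F (r a) (k b) ≢ 0
    nonzero′ a b ab = subst (_≢ 0) (H≈F _ _ λ ab∈ → ¬meets (a , b , ab , ab∈)) (nonzero a b ab)

  shadow-agree-⊇ : ∀ {F H} → AgreeOutsideShadow F H → ∀ {i j} → InShadow F i j → InShadow H i j
  shadow-agree-⊇ {F} {H} H≈F {i} = below c (m≤n+m c (toℕ i))
    where
    -- Recursion on the number of rows below i: the shadowed cell of the occurrence lies lower.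
    below : ∀ fuel {i j} → c ≤ toℕ i + fuel → InShadow F i j → InShadow H i j
    below zero    {i} c≤i _ = ⊥-elim (<⇒≱ (toℕ<n i) (subst (c ≤_) (+-identityʳ (toℕ i)) c≤i))
    below (suc fuel) {i} c≤i+ (shadowedBy r k (r↑ , k↑ , corner , nonzero) i< j<) with shadowMeets? F r k
    ... | yes (a , b , _ , ab∈) = InShadow-above r↑ k↑ i< j< (below fuel c≤ra+ ab∈)
      where
      c≤ra+ : c ≤ toℕ (r a) + fuel
      c≤ra+ = ≤-trans c≤i+ (subst (_≤ toℕ (r a) + fuel) (sym (+-suc (toℕ i) fuel))
                (+-monoˡ-≤ fuel (<-≤-trans i< (StrictlyIncreasing⇒monotone r↑ z≤n))))
    ... | no ¬meets = shadowedBy r k (r↑ , k↑ , corner , nonzero′) i< j<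
      where
      nonzero′ : ∀ a b → A a b ≡ true → entry H (r a) (k b) ≢ 0
      nonzero′ a b ab = subst (_≢ 0) (sym (H≈F _ _ λ ab∈ → ¬meets (a , b , ab , ab∈))) (nonzero a b ab)

  outside : Filling c d → Filling c d
  outside F = fromEntries λ i j → keepIf (¬? (inShadow? F i j)) (entry F i j)

  outside-inShadow : ∀ F {i j} → InShadow F i j → entry (outside F) i j ≡ 0
  outside-inShadow F {i} {j} ij∈ =
    trans (entry-fromEntries _ i j) (keepIf-no (¬? (inShadow? F i j)) _ λ ij∉ → ij∉ ij∈)

  outside-notInShadow : ∀ F {i j} → ¬ InShadow F i j → entry (outside F) i j ≡ entry F i j
  outside-notInShadow F {i} {j} ij∉ =
    trans (entry-fromEntries _ i j) (keepIf-yes (¬? (inShadow? F i j)) _ ij∉)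

  width : Filling c d → Fin c → ℕ
  width K i = prefixLength (inShadow? K i)

  width-sound : ∀ {K i j} → toℕ j < width K i → InShadow K i j
  width-sound {K} {i} = prefixLength-sound (inShadow? K i)

  width-complete : ∀ {K i j} → InShadow K i j → toℕ j < width K i
  width-complete {K} {i} = prefixLength-complete (inShadow? K i) (InShadow-downward ≤-refl)

  width-antitone : ∀ {K i i′} → toℕ i′ ≤ toℕ i → width K i ≤ width K i′
  width-antitone {K} {i} i′≤i =
    prefixLength≤ (inShadow? K i) (width-complete ∘ InShadow-downward i′≤i ≤-refl)

  shadowPart : Filling c d → Filling c d → Fin c → Fin d → ℕ
  shadowPart K F i j = keepIf (toℕ j <? width K i) (entry F i j)

  module _ {F K} (F↦K : outside F ≡ K) where

    InShadow-outside⁺ : ∀ {i j} → InShadow F i j → InShadow K i j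
    InShadow-outside⁺ ij∈ =
      subst (λ H → InShadow H _ _) F↦K (shadow-agree-⊇ {F} {outside F} (λ _ _ → outside-notInShadow F) ij∈)

    InShadow-outside⁻ : ∀ {i j} → InShadow K i j → InShadow F i j
    InShadow-outside⁻ ij∈ =
      shadow-agree-⊆ {F} {outside F} (λ _ _ → outside-notInShadow F) (subst (λ H → InShadow H _ _) (sym F↦K) ij∈)

    entry-outside-inShadow : ∀ {i j} → InShadow K i j → entry K i j ≡ 0
    entry-outside-inShadow ij∈ = trans (cong (λ H → entry H _ _) (sym F↦K)) (outside-inShadow F (InShadow-outside⁻ ij∈))

    entry-outside-notInShadow : ∀ {i j} → ¬ InShadow K i j → entry K i j ≡ entry F i j
    entry-outside-notInShadow ij∉ =
      trans (cong (λ H → entry H _ _) (sym F↦K)) (outside-notInShadow F (ij∉ ∘ InShadow-outside⁺))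

    entry-split : ∀ i j → entry F i j ≡ entry K i j + shadowPart K F i j
    entry-split i j with toℕ j <? width K i
    ... | yes j<w = sym (cong (_+ entry F i j) (entry-outside-inShadow (width-sound j<w)))
    ... | no  j≮w = trans (sym (entry-outside-notInShadow (j≮w ∘ width-complete))) (sym (+-identityʳ _))

ZeroOutside : ∀ {c d} → Ferrers c d → Filling c d → Set
ZeroOutside D F = ∀ i j → ¬ InDiagram D i j → entry F i j ≡ 0

module Reduction {c d} (D : Ferrers c d) {u v} (A : Matrix01 u v)
                 (ρ : Fin c → ℕ) (γ : Fin d → ℕ) (K : Filling c d) where
  open ShadowOf D A

  c′ : ℕ
  c′ = prefixLength λ i → any? (inShadow? K i)

  d′ : ℕ
  d′ = prefixLength λ j → any? λ i → inShadow? K i j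

  open Embedding (prefixLength≤n λ i → any? (inShadow? K i)) public
    renaming (embed to row; toℕ-embed to toℕ-row; unembed to row⁻¹; toℕ-unembed to toℕ-row⁻¹;
              embed-unembed to row-row⁻¹; unembed-embed to row⁻¹-row; embed< to row<c′)
  open Embedding (prefixLength≤n λ j → any? λ i → inShadow? K i j) public
    renaming (embed to col; toℕ-embed to toℕ-col; unembed to col⁻¹; toℕ-unembed to toℕ-col⁻¹;
              embed-unembed to col-col⁻¹; unembed-embed to col⁻¹-col; embed< to col<d′)

  inShadow⇒row< : ∀ {i j} → InShadow K i j → toℕ i < c′
  inShadow⇒row< ij∈ = prefixLength-complete _ (λ i′≤i (j , ij∈) → j , InShadow-downward i′≤i ≤-refl ij∈) (_ , ij∈)

  inShadow⇒col< : ∀ {i j} → InShadow K i j → toℕ j < d′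
  inShadow⇒col< ij∈ = prefixLength-complete _ (λ j′≤j (i , ij∈) → i , InShadow-downward ≤-refl j′≤j ij∈) (_ , ij∈)

  width≤d′ : ∀ i → width K i ≤ d′
  width≤d′ i = prefixLength≤ (inShadow? K i) inShadow⇒col<

  width-beyond-row : ∀ {i j} → c′ ≤ toℕ i → ¬ toℕ j < width K i
  width-beyond-row c′≤i j<w = <⇒≱ (inShadow⇒row< (width-sound j<w)) c′≤i

  width-beyond-col : ∀ {i j} → d′ ≤ toℕ j → ¬ toℕ j < width K i
  width-beyond-col d′≤j j<w = <⇒≱ (inShadow⇒col< (width-sound j<w)) d′≤j

  D′ : Ferrers c′ d′
  D′ = record
    { shape        = width K ∘ row
    ; decreasing   = λ i j i≤j → width-antitone (subst₂ _≤_ (sym (toℕ-row i)) (sym (toℕ-row j)) i≤j)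
    ; rowsNonempty = λ i → let j , ij∈ = prefixLength-sound _ (row<c′ i) in ≤-trans (s≤s z≤n) (width-complete ij∈)
    ; withinCols   = width≤d′ ∘ row
    ; colsNonempty = column-in-shape
    }
    where
    column-in-shape : ∀ j → ∃ λ i → toℕ j < width K (row i)
    column-in-shape j =
      let i , ij∈ = prefixLength-sound _ (col<d′ j)
      in row⁻¹ i (inShadow⇒row< ij∈) ,
         subst₂ (λ x y → x < width K y) (toℕ-col j) (sym (row-row⁻¹ i _)) (width-complete ij∈)

  InDiagram′⇒InShadow : ∀ {i j} → InDiagram D′ i j → InShadow K (row i) (col j)
  InDiagram′⇒InShadow {i} {j} ij∈ = width-sound (subst (_< width K (row i)) (sym (toℕ-col j)) ij∈)

  InShadow⇒InDiagram′ : ∀ {i j} → InShadow K (row i) (col j) → InDiagram D′ i j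
  InShadow⇒InDiagram′ {i} {j} ij∈ = subst (_< width K (row i)) (toℕ-col j) (width-complete ij∈)

  ρ′ : Fin c′ → ℕ
  ρ′ i = ρ (row i) ∸ rowSum K (row i)

  γ′ : Fin d′ → ℕ
  γ′ j = γ (col j) ∸ colSum K (col j)

  shadowPart-out : ∀ F {i j} → ¬ toℕ j < width K i → shadowPart K F i j ≡ 0
  shadowPart-out F {i} {j} = keepIf-no (toℕ j <? width K i) _

  restrict : Filling c d → Filling c′ d′
  restrict F = fromEntries λ i j → shadowPart K F (row i) (col j)

  entry-restrict : ∀ F i j → entry (restrict F) i j ≡ shadowPart K F (row i) (col j)
  entry-restrict F = entry-fromEntries _

  entry-restrict-in : ∀ F {i j} → InDiagram D′ i j → entry (restrict F) i j ≡ entry F (row i) (col j)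
  entry-restrict-in F {i} {j} ij∈ =
    trans (entry-restrict F i j) (keepIf-yes (_ <? _) _ (width-complete (InDiagram′⇒InShadow ij∈)))

  extend : Filling c′ d′ → Fin c → Fin d → ℕ
  extend G i j with toℕ j <? width K i
  ... | yes j<w = entry G (row⁻¹ i (inShadow⇒row< (width-sound j<w))) (col⁻¹ j (inShadow⇒col< (width-sound j<w)))
  ... | no _    = 0

  extend-in : ∀ G {i j} (j<w : toℕ j < width K i) →
              extend G i j ≡ entry G (row⁻¹ i (inShadow⇒row< (width-sound j<w))) (col⁻¹ j (inShadow⇒col< (width-sound j<w)))
  extend-in G {i} {j} j<w with toℕ j <? width K i
  ... | yes _   = refl
  ... | no j≮w = ⊥-elim (j≮w j<w)

  extend-out : ∀ G {i j} → ¬ toℕ j < width K i → extend G i j ≡ 0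
  extend-out G {i} {j} j≮w with toℕ j <? width K i
  ... | yes j<w = ⊥-elim (j≮w j<w)
  ... | no _    = refl

  extend-row-col : ∀ {G} → ZeroOutside D′ G → ∀ i j → extend G (row i) (col j) ≡ entry G i j
  extend-row-col {G} G-zero i j with toℕ (col j) <? width K (row i)
  ... | yes _   = cong₂ (entry G) (row⁻¹-row i _) (col⁻¹-col j _)
  ... | no j≮w = sym (G-zero i j (j≮w ∘ subst (_< width K (row i)) (sym (toℕ-col j))))

  glue : Filling c′ d′ → Filling c d
  glue G = fromEntries λ i j → entry K i j + extend G i j

  entry-glue : ∀ G i j → entry (glue G) i j ≡ entry K i j + extend G i j
  entry-glue G = entry-fromEntries _

  ZeroOnShadow : Set
  ZeroOnShadow = ∀ {i j} → InShadow K i j → entry K i j ≡ 0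

  restrict-glue : ∀ {G} → ZeroOnShadow → ZeroOutside D′ G → restrict (glue G) ≡ G
  restrict-glue {G} K-zero G-zero = filling-ext λ i j → entry-restrict-glue i j (inDiagram? D′ i j)
    where
    entry-restrict-glue : ∀ i j → Dec (InDiagram D′ i j) → entry (restrict (glue G)) i j ≡ entry G i j
    entry-restrict-glue i j (yes ij∈) = begin
      entry (restrict (glue G)) i j               ≡⟨ entry-restrict-in (glue G) ij∈ ⟩
      entry (glue G) (row i) (col j)              ≡⟨ entry-glue G (row i) (col j) ⟩
      entry K (row i) (col j) + extend G (row i) (col j)
                                                  ≡⟨ cong₂ _+_ (K-zero (InDiagram′⇒InShadow ij∈)) (extend-row-col G-zero i j) ⟩
      entry G i j                                 ∎
      where open ≡-Reasoning
    entry-restrict-glue i j (no ij∉) =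
      trans (entry-restrict (glue G) i j)
            (trans (shadowPart-out (glue G) (ij∉ ∘ subst (_< width K (row i)) (toℕ-col j))) (sym (G-zero i j ij∉)))

  module _ {F} (F↦K : outside F ≡ K) where

    glue-restrict : glue (restrict F) ≡ F
    glue-restrict = filling-ext λ i j → trans (entry-glue _ i j) (entry-glue-restrict i j (toℕ j <? width K i))
      where
      entry-glue-restrict : ∀ i j → Dec (toℕ j < width K i) → entry K i j + extend (restrict F) i j ≡ entry F i j
      entry-glue-restrict i j (yes j<w) = cong₂ _+_ (entry-outside-inShadow F↦K ij∈) extend≡
        where
        ij∈ = width-sound j<w
        i<c′ = inShadow⇒row< ij∈
        j<d′ = inShadow⇒col< ij∈
        extend≡ : extend (restrict F) i j ≡ entry F i j
        extend≡ = begin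
          extend (restrict F) i j                                ≡⟨ extend-in (restrict F) j<w ⟩
          entry (restrict F) (row⁻¹ i i<c′) (col⁻¹ j j<d′)       ≡⟨ entry-restrict F _ _ ⟩
          shadowPart K F (row (row⁻¹ i i<c′)) (col (col⁻¹ j j<d′))
            ≡⟨ cong₂ (shadowPart K F) (row-row⁻¹ i i<c′) (col-col⁻¹ j j<d′) ⟩
          shadowPart K F i j                                       ≡⟨ keepIf-yes (toℕ j <? width K i) _ j<w ⟩
          entry F i j                                            ∎
          where open ≡-Reasoning
      entry-glue-restrict i j (no j≮w) =
        trans (cong₂ _+_ (entry-outside-notInShadow F↦K (j≮w ∘ width-complete)) (extend-out (restrict F) j≮w))
              (+-identityʳ _)

  outside-glue : ZeroOnShadow → ∀ G → outside (glue G) ≡ K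
  outside-glue K-zero G = filling-ext λ i j → entry-outside-glue i j (inShadow? (glue G) i j)
    where
    glue≈K : AgreeOutsideShadow K (glue G)
    glue≈K i j ij∉ = trans (entry-glue G i j)
                       (trans (cong (entry K i j +_) (extend-out G (ij∉ ∘ width-sound))) (+-identityʳ _))
    entry-outside-glue : ∀ i j → Dec (InShadow (glue G) i j) → entry (outside (glue G)) i j ≡ entry K i j
    entry-outside-glue i j (yes ij∈) =
      trans (outside-inShadow (glue G) ij∈) (sym (K-zero (shadow-agree-⊆ glue≈K ij∈)))
    entry-outside-glue i j (no ij∉) =
      trans (outside-notInShadow (glue G) ij∉) (glue≈K i j (ij∉ ∘ shadow-agree-⊇ glue≈K))

  -- The conditions on K under which glue turns allowed fillings of D′ into allowed fillings of D.
  record Feasible : Set where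
    field
      zeroOutside   : ZeroOutside D K
      zeroOnShadow  : ZeroOnShadow
      rowSum≤       : ∀ i → rowSum K i ≤ ρ i
      colSum≤       : ∀ j → colSum K j ≤ γ j
      rowSum-beyond : ∀ i → c′ ≤ toℕ i → rowSum K i ≡ ρ i
      colSum-beyond : ∀ j → d′ ≤ toℕ j → colSum K j ≡ γ j

  feasible? : Dec Feasible
  feasible? =
    map′ (λ (z , s , r , c , r′ , c′) → record
           { zeroOutside = z ; zeroOnShadow = s _ _ ; rowSum≤ = r ; colSum≤ = c ; rowSum-beyond = r′ ; colSum-beyond = c′ })
         (λ f → let open Feasible f in zeroOutside , (λ _ _ → zeroOnShadow) , rowSum≤ , colSum≤ , rowSum-beyond , colSum-beyond)
         ((all? λ i → all? λ j → ¬? (inDiagram? D i j) →-dec (entry K i j ≟ 0)) ×-dec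
          (all? λ i → all? λ j → inShadow? K i j →-dec (entry K i j ≟ 0)) ×-dec
          (all? λ i → rowSum K i ≤? ρ i) ×-dec (all? λ j → colSum K j ≤? γ j) ×-dec
          (all? λ i → (c′ ≤? toℕ i) →-dec (rowSum K i ≟ ρ i)) ×-dec
          (all? λ j → (d′ ≤? toℕ j) →-dec (colSum K j ≟ γ j)))

  rowSum-restrict : ∀ F i → rowSum (restrict F) i ≡ sum (shadowPart K F (row i))
  rowSum-restrict F i =
    trans (rowSum≡∑ (restrict F) i)
      (trans (sum-cong-≗ (entry-restrict F i))
        (sym (∑-inject≤ _ (shadowPart K F (row i))
               λ j d′≤j → shadowPart-out F (width-beyond-col d′≤j))))

  colSum-restrict : ∀ F j → colSum (restrict F) j ≡ sum (λ i → shadowPart K F i (col j))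
  colSum-restrict F j =
    trans (colSum≡∑ (restrict F) j)
      (trans (sum-cong-≗ (λ i → entry-restrict F i j))
        (sym (∑-inject≤ _ (λ i → shadowPart K F i (col j))
               λ i c′≤i → shadowPart-out F (width-beyond-row c′≤i))))

  rowSum-glue : ∀ G i → rowSum (glue G) i ≡ rowSum K i + sum (extend G i)
  rowSum-glue G i = trans (rowSum≡∑ (glue G) i) (trans (∑-+ (entry-glue G i)) (cong (_+ sum (extend G i)) (sym (rowSum≡∑ K i))))

  colSum-glue : ∀ G j → colSum (glue G) j ≡ colSum K j + sum (λ i → extend G i j)
  colSum-glue G j =
    trans (colSum≡∑ (glue G) j)
      (trans (∑-+ (λ i → entry-glue G i j)) (cong (_+ sum (λ i → extend G i j)) (sym (colSum≡∑ K j))))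

  module _ {G} (G-zero : ZeroOutside D′ G) where

    sum-extend-row : ∀ i → sum (extend G (row i)) ≡ rowSum G i
    sum-extend-row i =
      trans (∑-inject≤ _ (extend G (row i)) λ j d′≤j → extend-out G (width-beyond-col d′≤j))
        (trans (sum-cong-≗ (extend-row-col G-zero i)) (sym (rowSum≡∑ G i)))

    sum-extend-col : ∀ j → sum (λ i → extend G i (col j)) ≡ colSum G j
    sum-extend-col j =
      trans (∑-inject≤ _ (λ i → extend G i (col j)) λ i c′≤i → extend-out G (width-beyond-row c′≤i))
        (trans (sum-cong-≗ λ i → extend-row-col G-zero i j) (sym (colSum≡∑ G j)))

  module _ {F} (F↦K : outside F ≡ K) (F-allowed : Allowed D ρ γ F) where
    private
      F-zero = proj₁ F-allowed
      F-row  = proj₁ (proj₂ F-allowed)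
      F-col  = proj₂ (proj₂ F-allowed)

    rowSum-split : ∀ i → ρ i ≡ rowSum K i + sum (shadowPart K F i)
    rowSum-split i = trans (sym (F-row i))
      (trans (rowSum≡∑ F i) (trans (∑-+ (entry-split F↦K i)) (cong (_+ sum (shadowPart K F i)) (sym (rowSum≡∑ K i)))))

    colSum-split : ∀ j → γ j ≡ colSum K j + sum (λ i → shadowPart K F i j)
    colSum-split j = trans (sym (F-col j))
      (trans (colSum≡∑ F j) (trans (∑-+ (λ i → entry-split F↦K i j))
        (cong (_+ sum (λ i → shadowPart K F i j)) (sym (colSum≡∑ K j)))))

    restrict-allowed : Allowed D′ ρ′ γ′ (restrict F)
    restrict-allowed = zero-outside , row-sum , col-sum
      where
      zero-outside : ZeroOutside D′ (restrict F)
      zero-outside i j ij∉ =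
        trans (entry-restrict F i j) (shadowPart-out F (ij∉ ∘ subst (_< width K (row i)) (toℕ-col j)))
      row-sum : ∀ i → rowSum (restrict F) i ≡ ρ′ i
      row-sum i = trans (rowSum-restrict F i)
        (sym (trans (cong (_∸ rowSum K (row i)) (rowSum-split (row i))) (m+n∸m≡n (rowSum K (row i)) _)))
      col-sum : ∀ j → colSum (restrict F) j ≡ γ′ j
      col-sum j = trans (colSum-restrict F j)
        (sym (trans (cong (_∸ colSum K (col j)) (colSum-split (col j))) (m+n∸m≡n (colSum K (col j)) _)))

    feasible : Feasible
    feasible = record
      { zeroOutside   = λ i j ij∉ → trans (entry-outside-notInShadow F↦K (ij∉ ∘ InShadow⇒InDiagram)) (F-zero i j ij∉)
      ; zeroOnShadow  = entry-outside-inShadow F↦K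
      ; rowSum≤       = λ i → subst (rowSum K i ≤_) (sym (rowSum-split i)) (m≤m+n _ _)
      ; colSum≤       = λ j → subst (colSum K j ≤_) (sym (colSum-split j)) (m≤m+n _ _)
      ; rowSum-beyond = λ i c′≤i → sym (trans (rowSum-split i)
          (trans (cong (rowSum K i +_) (∑-zero {f = shadowPart K F i} λ j → shadowPart-out F (width-beyond-row c′≤i))) (+-identityʳ _)))
      ; colSum-beyond = λ j d′≤j → sym (trans (colSum-split j)
          (trans (cong (colSum K j +_) (∑-zero {f = λ i → shadowPart K F i j} λ i → shadowPart-out F (width-beyond-col d′≤j))) (+-identityʳ _)))
      }

  module _ (K-feasible : Feasible) {G} (G-allowed : Allowed D′ ρ′ γ′ G) where
    open Feasible K-feasible
    private
      G-zero = proj₁ G-allowed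
      G-row  = proj₁ (proj₂ G-allowed)
      G-col  = proj₂ (proj₂ G-allowed)

    glue-allowed : Allowed D ρ γ (glue G)
    glue-allowed = zero-outside , row-sum , col-sum
      where
      zero-outside : ZeroOutside D (glue G)
      zero-outside i j ij∉ = trans (entry-glue G i j)
        (cong₂ _+_ (zeroOutside i j ij∉) (extend-out G (ij∉ ∘ InShadow⇒InDiagram ∘ width-sound)))
      row-sum-in : ∀ i → rowSum (glue G) (row i) ≡ ρ (row i)
      row-sum-in i = begin
        rowSum (glue G) (row i)                                ≡⟨ rowSum-glue G (row i) ⟩
        rowSum K (row i) + sum (extend G (row i))              ≡⟨ cong (rowSum K (row i) +_) (sum-extend-row G-zero i) ⟩
        rowSum K (row i) + rowSum G i                          ≡⟨ cong (rowSum K (row i) +_) (G-row i) ⟩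
        rowSum K (row i) + (ρ (row i) ∸ rowSum K (row i))      ≡⟨ m+[n∸m]≡n (rowSum≤ (row i)) ⟩
        ρ (row i)                                              ∎
        where open ≡-Reasoning
      row-sum : ∀ i → rowSum (glue G) i ≡ ρ i
      row-sum i with toℕ i <? c′
      ... | yes i<c′ = subst (λ i → rowSum (glue G) i ≡ ρ i) (row-row⁻¹ i i<c′) (row-sum-in (row⁻¹ i i<c′))
      ... | no  i≮c′ = trans (rowSum-glue G i)
        (trans (cong (rowSum K i +_) (∑-zero {f = extend G i} λ j → extend-out G (width-beyond-row (≮⇒≥ i≮c′))))
               (trans (+-identityʳ _) (rowSum-beyond i (≮⇒≥ i≮c′))))
      col-sum-in : ∀ j → colSum (glue G) (col j) ≡ γ (col j)
      col-sum-in j = begin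
        colSum (glue G) (col j)                                ≡⟨ colSum-glue G (col j) ⟩
        colSum K (col j) + sum (λ i → extend G i (col j))      ≡⟨ cong (colSum K (col j) +_) (sum-extend-col G-zero j) ⟩
        colSum K (col j) + colSum G j                          ≡⟨ cong (colSum K (col j) +_) (G-col j) ⟩
        colSum K (col j) + (γ (col j) ∸ colSum K (col j))      ≡⟨ m+[n∸m]≡n (colSum≤ (col j)) ⟩
        γ (col j)                                              ∎
        where open ≡-Reasoning
      col-sum : ∀ j → colSum (glue G) j ≡ γ j
      col-sum j with toℕ j <? d′
      ... | yes j<d′ = subst (λ j → colSum (glue G) j ≡ γ j) (col-col⁻¹ j j<d′) (col-sum-in (col⁻¹ j j<d′))
      ... | no  j≮d′ = trans (colSum-glue G j)
        (trans (cong (colSum K j +_) (∑-zero {f = λ i → extend G i j} λ i → extend-out G (width-beyond-col (≮⇒≥ j≮d′))))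
               (trans (+-identityʳ _) (colSum-beyond j (≮⇒≥ j≮d′))))

StrictlyIncreasing-∘ : ∀ {l m n} {f : Fin m → Fin n} {g : Fin l → Fin m} →
                       StrictlyIncreasing f → StrictlyIncreasing g → StrictlyIncreasing (f ∘ g)
StrictlyIncreasing-∘ f↑ g↑ x y x<y = f↑ _ _ (g↑ x y x<y)

↑ˡ-strictlyIncreasing : ∀ {m} n → StrictlyIncreasing {m} (_↑ˡ n)
↑ˡ-strictlyIncreasing n x y x<y = subst₂ _<_ (sym (toℕ-↑ˡ x n)) (sym (toℕ-↑ˡ y n)) x<y

↑ʳ-strictlyIncreasing : ∀ m {n} → StrictlyIncreasing {n} (m ↑ʳ_)
↑ʳ-strictlyIncreasing m x y x<y = subst₂ _<_ (sym (toℕ-↑ʳ m x)) (sym (toℕ-↑ʳ m y)) (+-monoʳ-< m x<y)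

↑ˡ<↑ʳ : ∀ {m n} (x : Fin m) (y : Fin n) → toℕ (x ↑ˡ n) < toℕ (m ↑ʳ y)
↑ˡ<↑ʳ {m} {n} x y = subst₂ _<_ (sym (toℕ-↑ˡ x n)) (sym (toℕ-↑ʳ m y)) (<-≤-trans (toℕ<n x) (m≤m+n m (toℕ y)))

fromℕ-+ : ∀ m n → fromℕ (m + suc n) ≡ suc m ↑ʳ fromℕ n
fromℕ-+ m n = toℕ-injective (trans (toℕ-fromℕ (m + suc n))
  (trans (+-suc m n) (sym (trans (toℕ-↑ʳ (suc m) (fromℕ n)) (cong (λ z → suc (m + z)) (toℕ-fromℕ n))))))

++-strictlyIncreasing : ∀ {m n N} {f : Fin m → Fin N} {g : Fin n → Fin N} →
                        StrictlyIncreasing f → StrictlyIncreasing g → (∀ a b → toℕ (f a) < toℕ (g b)) →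
                        StrictlyIncreasing (f Vector.++ g)
++-strictlyIncreasing {m} {n} f↑ g↑ f<g x y x<y with splitAt m x in x≡ | splitAt m y in y≡
... | inj₁ a | inj₁ b = f↑ a b (subst₂ _<_ (position-ˡ x≡) (position-ˡ y≡) x<y)
  where
  position-ˡ : ∀ {z a} → splitAt m z ≡ inj₁ a → toℕ z ≡ toℕ a
  position-ˡ {a = a} z≡ = trans (cong toℕ (sym (splitAt⁻¹-↑ˡ z≡))) (toℕ-↑ˡ a n)
... | inj₂ a | inj₂ b = g↑ a b (+-cancelˡ-< m (toℕ a) (toℕ b) (subst₂ _<_ (position-ʳ x≡) (position-ʳ y≡) x<y))
  where
  position-ʳ : ∀ {z a} → splitAt m z ≡ inj₂ a → toℕ z ≡ m + toℕ a
  position-ʳ {a = a} z≡ = trans (cong toℕ (sym (splitAt⁻¹-↑ʳ z≡))) (toℕ-↑ʳ m a)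
... | inj₁ a | inj₂ b = f<g a b
... | inj₂ a | inj₁ b = ⊥-elim (<-asym x<y (subst₂ _<_ (sym y≡b) (sym x≡a) (↑ˡ<↑ʳ b a)))
  where
  y≡b = cong toℕ (sym (splitAt⁻¹-↑ˡ y≡))
  x≡a = cong toℕ (sym (splitAt⁻¹-↑ʳ x≡))

module _ {s t u v} (M : Matrix01 s t) (A : Matrix01 u v) where

  block-↑ˡ : ∀ a b → block M A (a ↑ˡ suc u) (b ↑ˡ suc v) ≡ M a b
  block-↑ˡ a b rewrite splitAt-↑ˡ (suc s) a (suc u) | splitAt-↑ˡ (suc t) b (suc v) = refl

  block-↑ʳ : ∀ a b → block M A (suc s ↑ʳ a) (suc t ↑ʳ b) ≡ A a b
  block-↑ʳ a b rewrite splitAt-↑ʳ (suc s) (suc u) a | splitAt-↑ʳ (suc t) (suc v) b = refl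

  block-nonzero : ∀ {c d} (F : Filling c d) {rM rA kM kA} →
                  (∀ a b → M a b ≡ true → entry F (rM a) (kM b) ≢ 0) →
                  (∀ a b → A a b ≡ true → entry F (rA a) (kA b) ≢ 0) →
                  ∀ x y → block M A x y ≡ true → entry F ((rM Vector.++ rA) x) ((kM Vector.++ kA) y) ≢ 0
  block-nonzero F M-nonzero A-nonzero x y with splitAt (suc s) x | splitAt (suc t) y
  ... | inj₁ a | inj₁ b = M-nonzero a b
  ... | inj₂ a | inj₂ b = A-nonzero a b
  ... | inj₁ _ | inj₂ _ = λ ()
  ... | inj₂ _ | inj₁ _ = λ ()

module _ {c d} (D : Ferrers c d) {u v} (A : Matrix01 u v) where
  open ShadowOf D A

  -- The A-block of an occurrence of [M|A] is exactly what puts the corner of its M-block in the shadow.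
  contains-block⇔ : ∀ {s t} (M : Matrix01 s t) F → Contains (block M A) D F ⇔ ContainsWithCorner (InShadow F) M F
  contains-block⇔ {s} {t} M F = mk⇔ split join
    where
    split : Contains (block M A) D F → ContainsWithCorner (InShadow F) M F
    split (r , k , r↑ , k↑ , corner , nonzero) =
      r ∘ (_↑ˡ suc u) , k ∘ (_↑ˡ suc v) ,
      StrictlyIncreasing-∘ r↑ (↑ˡ-strictlyIncreasing _) , StrictlyIncreasing-∘ k↑ (↑ˡ-strictlyIncreasing _) ,
      shadowedBy (r ∘ (suc s ↑ʳ_)) (k ∘ (suc t ↑ʳ_))
        (StrictlyIncreasing-∘ r↑ (↑ʳ-strictlyIncreasing _) , StrictlyIncreasing-∘ k↑ (↑ʳ-strictlyIncreasing _) ,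
         subst₂ (InDiagram D) (cong r (fromℕ-+ s u)) (cong k (fromℕ-+ t v)) corner ,
         λ a b aab → nonzero _ _ (trans (block-↑ʳ M A a b) aab))
        (r↑ _ _ (↑ˡ<↑ʳ (fromℕ s) Fin.zero)) (k↑ _ _ (↑ˡ<↑ʳ (fromℕ t) Fin.zero)) ,
      λ a b mab → nonzero _ _ (trans (block-↑ˡ M A a b) mab)
    join : ContainsWithCorner (InShadow F) M F → Contains (block M A) D F
    join (rM , kM , rM↑ , kM↑ , shadowedBy rA kA (rA↑ , kA↑ , cornerA , nonzeroA) below right , nonzeroM) =
      rM Vector.++ rA , kM Vector.++ kA ,
      ++-strictlyIncreasing rM↑ rA↑ (λ a b → ≤-<-trans (StrictlyIncreasing⇒monotone rM↑ (≤fromℕ a))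
                                              (<-≤-trans below (StrictlyIncreasing⇒monotone rA↑ z≤n))) ,
      ++-strictlyIncreasing kM↑ kA↑ (λ a b → ≤-<-trans (StrictlyIncreasing⇒monotone kM↑ (≤fromℕ a))
                                              (<-≤-trans right (StrictlyIncreasing⇒monotone kA↑ z≤n))) ,
      subst₂ (InDiagram D) (sym (trans (cong (rM Vector.++ rA) (fromℕ-+ s u)) (lookup-++ʳ rM rA (fromℕ u))))
                           (sym (trans (cong (kM Vector.++ kA) (fromℕ-+ t v)) (lookup-++ʳ kM kA (fromℕ v)))) cornerA ,
      block-nonzero M A F nonzeroM nonzeroA

module _ {c d} (D : Ferrers c d) {u v} (A : Matrix01 u v) (ρ : Fin c → ℕ) (γ : Fin d → ℕ) (K : Filling c d) where
  open ShadowOf D A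
  open Reduction D A ρ γ K

  restrict-contains⇔ : ∀ {s t} (M : Matrix01 s t) F → ContainsWithCorner (InShadow K) M F ⇔ Contains M D′ (restrict F)
  restrict-contains⇔ {s} {t} M F = mk⇔ to from
    where
    to : ContainsWithCorner (InShadow K) M F → Contains M D′ (restrict F)
    to (r , k , r↑ , k↑ , corner , nonzero) = r′ , k′ , r′↑ , k′↑ , corner′ , nonzero′
      where
      inShadow : ∀ a b → InShadow K (r a) (k b)
      inShadow a b = InShadow-downward (StrictlyIncreasing⇒monotone r↑ (≤fromℕ a))
                                       (StrictlyIncreasing⇒monotone k↑ (≤fromℕ b)) corner
      r′ : Fin (suc s) → Fin c′
      r′ a = row⁻¹ (r a) (inShadow⇒row< (inShadow a Fin.zero))
      k′ : Fin (suc t) → Fin d′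
      k′ b = col⁻¹ (k b) (inShadow⇒col< (inShadow Fin.zero b))
      r′↑ : StrictlyIncreasing r′
      r′↑ x y x<y = subst₂ _<_ (sym (toℕ-row⁻¹ _ _)) (sym (toℕ-row⁻¹ _ _)) (r↑ x y x<y)
      k′↑ : StrictlyIncreasing k′
      k′↑ x y x<y = subst₂ _<_ (sym (toℕ-col⁻¹ _ _)) (sym (toℕ-col⁻¹ _ _)) (k↑ x y x<y)
      row-r′ : ∀ a → row (r′ a) ≡ r a
      row-r′ a = row-row⁻¹ (r a) _
      col-k′ : ∀ b → col (k′ b) ≡ k b
      col-k′ b = col-col⁻¹ (k b) _
      inDiagram′ : ∀ a b → InDiagram D′ (r′ a) (k′ b)
      inDiagram′ a b = InShadow⇒InDiagram′ (subst₂ (InShadow K) (sym (row-r′ a)) (sym (col-k′ b)) (inShadow a b))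
      corner′ : InDiagram D′ (r′ (fromℕ s)) (k′ (fromℕ t))
      corner′ = inDiagram′ (fromℕ s) (fromℕ t)
      nonzero′ : ∀ a b → M a b ≡ true → entry (restrict F) (r′ a) (k′ b) ≢ 0
      nonzero′ a b mab = subst (_≢ 0)
        (sym (trans (entry-restrict-in F (inDiagram′ a b)) (cong₂ (entry F) (row-r′ a) (col-k′ b))))
        (nonzero a b mab)
    from : Contains M D′ (restrict F) → ContainsWithCorner (InShadow K) M F
    from (r′ , k′ , r′↑ , k′↑ , corner′ , nonzero′) =
      row ∘ r′ , col ∘ k′ ,
      (λ x y x<y → subst₂ _<_ (sym (toℕ-row (r′ x))) (sym (toℕ-row (r′ y))) (r′↑ x y x<y)) ,
      (λ x y x<y → subst₂ _<_ (sym (toℕ-col (k′ x))) (sym (toℕ-col (k′ y))) (k′↑ x y x<y)) ,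
      InDiagram′⇒InShadow corner′ ,
      λ a b mab → proj₂ (keepIf≢0 _ _ (subst (_≢ 0) (entry-restrict F (r′ a) (k′ b)) (nonzero′ a b mab)))

  contains-block⇔restrict : ∀ {s t} (M : Matrix01 s t) {F} → outside F ≡ K →
                            Contains (block M A) D F ⇔ Contains M D′ (restrict F)
  contains-block⇔restrict M {F} F↦K = mk⇔
    (λ cb → Equivalence.to (restrict-contains⇔ M F) (shadow-K (Equivalence.to (contains-block⇔ D A M F) cb)))
    (λ cr → Equivalence.from (contains-block⇔ D A M F) (shadow-F (Equivalence.from (restrict-contains⇔ M F) cr)))
    where
    shadow-K : ContainsWithCorner (InShadow F) M F → ContainsWithCorner (InShadow K) M F
    shadow-K = ContainsWithCorner-mono {C = InShadow F} {InShadow K} {M} {F} (InShadow-outside⁺ F↦K)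
    shadow-F : ContainsWithCorner (InShadow K) M F → ContainsWithCorner (InShadow F) M F
    shadow-F = ContainsWithCorner-mono {C = InShadow K} {InShadow F} {M} {F} (InShadow-outside⁻ F↦K)

AllowedAvoiding : ∀ {s t c d} → Matrix01 s t → Ferrers c d → (Fin c → ℕ) → (Fin d → ℕ) → Filling c d → Set
AllowedAvoiding M D ρ γ F = Allowed D ρ γ F × Avoids M D F

CountsTransfer : ∀ {s t s′ t′} → Matrix01 s t → Matrix01 s′ t′ → Set
CountsTransfer M N = ∀ c d (D : Ferrers c d) ρ γ {n} →
  HasCard (AllowedAvoiding M D ρ γ) n → HasCard (AllowedAvoiding N D ρ γ) n

module _ {c d} (D : Ferrers c d) {u v} (A : Matrix01 u v) (ρ : Fin c → ℕ) (γ : Fin d → ℕ) where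
  open ShadowOf D A
  module Reduced (K : Filling c d) = Reduction D A ρ γ K
  open Reduced using (c′; d′; D′; ρ′; γ′)

  open FibreTransfer _≟-filling_ outside {Y = λ K → Filling (c′ K) (d′ K)} _≟-filling_
                     Reduced.restrict Reduced.glue (λ F → Reduced.glue-restrict (outside F) refl) Reduced.feasible?
    public

  block-decomposes : ∀ {s t} (M : Matrix01 s t) →
                     Decomposes (AllowedAvoiding (block M A) D ρ γ) (λ K → AllowedAvoiding M (D′ K) (ρ′ K) (γ′ K))
  block-decomposes M = record
    { realisable     = λ (F-allowed , _) → Reduced.feasible _ refl F-allowed
    ; restrict-sound = λ {F} (F-allowed , F-avoids) →
        Reduced.restrict-allowed _ refl F-allowed ,
        F-avoids ∘ Equivalence.from (contains-block⇔restrict D A ρ γ _ M refl)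
    ; glue-sound     = λ {K} {G} K-feasible (G-allowed , G-avoids) →
        let K-zero = Reduced.Feasible.zeroOnShadow K-feasible
            G≡     = Reduced.restrict-glue K K-zero (proj₁ G-allowed)
        in Reduced.glue-allowed K K-feasible G-allowed ,
           G-avoids ∘ subst (Contains M (D′ K)) G≡
             ∘ Equivalence.to (contains-block⇔restrict D A ρ γ K M (Reduced.outside-glue K K-zero G))
    ; κ-glue         = λ {K} {G} K-feasible _ → Reduced.outside-glue K (Reduced.Feasible.zeroOnShadow K-feasible) G
    ; restrict-glue  = λ {K} K-feasible (G-allowed , _) →
        Reduced.restrict-glue K (Reduced.Feasible.zeroOnShadow K-feasible) (proj₁ G-allowed)
    }

block-countsTransfer : ∀ {s t s′ t′ u v} {M : Matrix01 s t} {N : Matrix01 s′ t′} (A : Matrix01 u v) →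
                       CountsTransfer M N → CountsTransfer (block M A) (block N A)
block-countsTransfer {M = M} {N} A M⇒N c d D ρ γ =
  transfer D A ρ γ (block-decomposes D A ρ γ M) (block-decomposes D A ρ γ N)
    λ {K} _ → M⇒N _ _ (Reduction.D′ D A ρ γ K) _ _

proposition4p1 : ∀ {s t s' t' u v} (M : Matrix01 s t) (N : Matrix01 s' t') (A : Matrix01 u v) →
    Equirestrictive M N → Equirestrictive (block M A) (block N A)
proposition4p1 M N A M≈N c d D ρ γ n = mk⇔
  (block-countsTransfer A (λ c d D ρ γ {n} → Equivalence.to (M≈N c d D ρ γ n)) c d D ρ γ)
  (block-countsTransfer A (λ c d D ρ γ {n} → Equivalence.from (M≈N c d D ρ γ n)) c d D ρ γ)
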